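{- There exist a connected graph $G$, a coloring $\mathrm{col}$ of $G$ and a vertex $p$ of $G$ such that $\mathrm{OPT}_{\mathrm{Fixed}}(G,\mathrm{col},p)=2\,\mathrm{OPT}_{\mathrm{Free}}(G,\mathrm{col})$ (with $\mathrm{OPT}_{\mathrm{Free}}(G,\mathrm{col})>0$).
   Context: For a graph $G=(V,E)$ and a coloring $\mathrm{col}\colon V\to[c_{\max}]$, $\mathrm{Comp}(\mathrm{col},u)$ denotes the monochromatic connected component containing $u$. A move is a pair $(u,c)$ with $u\in V$ and $c\in[c_{\max}]$; its result is the coloring obtained by recoloring every vertex of $\mathrm{Comp}(\mathrm{col},u)$ with $c$, other vertices unchanged. Moves in a sequence are applied successively. $\mathrm{OPT}_{\mathrm{Free}}(G,\mathrm{col})$ is the minimum number of moves in a sequence whose result is a constant coloring; $\mathrm{OPT}_{\mathrm{Fixed}}(G,\mathrm{col},p)$ is the minimum number of moves in such a sequence in which every move is of the form $(p,c)$. -}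

module Defs where

open import Data.Nat using (ℕ; zero; suc; _+_; _*_; _≤_; _<_)
open import Data.Fin using (Fin)
open import Data.Bool using (Bool; true; false)
open import Data.List using (List; []; _∷_; length)
open import Data.List.Relation.Unary.All using (All)
open import Data.Product using (Σ; ∃; _×_; _,_)
open import Relation.Nullary using (¬_)
open import Relation.Binary.PropositionalEquality using (_≡_)

record Graph (n : ℕ) : Set where
  field
    Adj   : Fin n → Fin n → Bool
    sym   : ∀ u v → Adj u v ≡ Adj v u
    irrfl : ∀ u → Adj u u ≡ false
open Graph public

Coloring : ℕ → ℕ → Set
Coloring n cmax = Fin n → Fin cmax

data Reach {n : ℕ} (G : Graph n) (u : Fin n) : Fin n → Set where
  here : Reach G u u
  step : ∀ {v w} → Reach G u v → Adj G v w ≡ true → Reach G u w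

Connected : {n : ℕ} → Graph n → Set
Connected {n} G = ∀ (u v : Fin n) → Reach G u v

-- w ∈ Comp(col, u): w reachable from u by a walk along edges whose
-- endpoints have the same color (hence the whole walk is monochromatic).
data InComp {n cmax : ℕ} (G : Graph n) (col : Coloring n cmax) (u : Fin n)
     : Fin n → Set where
  here : InComp G col u u
  step : ∀ {v w} → InComp G col u v → Adj G v w ≡ true → col v ≡ col w
       → InComp G col u w

Move : ℕ → ℕ → Set
Move n cmax = Fin n × Fin cmax

MoveResult : {n cmax : ℕ} → Graph n → Coloring n cmax → Move n cmax
           → Coloring n cmax → Set
MoveResult {n} G col (u , c) col' =
  ∀ (w : Fin n) → (InComp G col u w → col' w ≡ c)
                × (¬ InComp G col u w → col' w ≡ col w)

data SeqResult {n cmax : ℕ} (G : Graph n)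
     : Coloring n cmax → List (Move n cmax) → Coloring n cmax → Set where
  done : ∀ {col} → SeqResult G col [] col
  cons : ∀ {col col₁ col₂ m ms} → MoveResult G col m col₁
       → SeqResult G col₁ ms col₂ → SeqResult G col (m ∷ ms) col₂

Constant : {n cmax : ℕ} → Coloring n cmax → Set
Constant {n} {cmax} col = Σ (Fin cmax) λ c → ∀ (v : Fin n) → col v ≡ c

Floods : {n cmax : ℕ} → Graph n → Coloring n cmax → List (Move n cmax) → Set
Floods {n} {cmax} G col ms =
  Σ (Coloring n cmax) λ col' → SeqResult G col ms col' × Constant col'

AtPivot : {n cmax : ℕ} → Fin n → List (Move n cmax) → Set
AtPivot {n} {cmax} p ms = All (λ m → Σ (Fin cmax) λ c → m ≡ (p , c)) ms

IsOPTFree : {n cmax : ℕ} → Graph n → Coloring n cmax → ℕ → Set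
IsOPTFree {n} {cmax} G col k =
  (Σ (List (Move n cmax)) λ ms → Floods G col ms × length ms ≡ k)
  × (∀ (ms : List (Move n cmax)) → Floods G col ms → k ≤ length ms)

IsOPTFixed : {n cmax : ℕ} → Graph n → Coloring n cmax → Fin n → ℕ → Set
IsOPTFixed {n} {cmax} G col p k =
  (Σ (List (Move n cmax)) λ ms → AtPivot p ms × Floods G col ms × length ms ≡ k)
  × (∀ (ms : List (Move n cmax)) → AtPivot p ms → Floods G col ms → k ≤ length ms)

-- Witness: the path 0 — 1 — 2 coloured red, blue, red, with pivot 0.
-- Free flooding takes one move (recolour the middle vertex red), and no
-- sequence of zero moves floods because the colouring is not constant,
-- so OPT_Free = 1.  At the pivot, Comp(col, 0) = {0}; the first move
-- therefore leaves vertices 1 and 2 untouched, and they still carry the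
-- distinct colours blue and red.  Hence one pivot move never floods, while
-- two suffice (recolour 0 blue, absorbing 1, then everything red), so
-- OPT_Fixed = 2.
module Submission where

open import Defs
open import Data.Nat using (ℕ; _*_; _≤_; _<_; z≤n; s≤s)
open import Data.Fin using (Fin; zero; suc)
open import Data.Product using (Σ; _×_; _,_; proj₂)
open import Data.Bool using (Bool; true; false)
open import Data.List using (List; []; _∷_; length)
open import Data.List.Relation.Unary.All using ([]; _∷_)
open import Data.Empty using (⊥-elim)
open import Relation.Nullary using (¬_)
open import Relation.Binary.PropositionalEquality
  using (_≡_; _≢_; refl; trans) renaming (sym to ≡-sym)

constant⇒equal : {n cmax : ℕ} {col : Coloring n cmax} → Constant col
               → ∀ v w → col v ≡ col w
constant⇒equal (c , const) v w = trans (const v) (≡-sym (const w))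

module _ {n cmax : ℕ} {G : Graph n} where

  nonconstant⇒needs-move : {col : Coloring n cmax} → ¬ Constant col
                          → ∀ ms → Floods G col ms → 1 ≤ length ms
  nonconstant⇒needs-move ¬const []      (_ , done , const) = ⊥-elim (¬const const)
  nonconstant⇒needs-move ¬const (_ ∷ _) _                  = s≤s z≤n

  -- A move at u cannot produce a constant colouring if two vertices outside
  -- Comp(col, u) have different colours: the move does not touch them.
  move-keeps-outside-distinct :
    {col col' : Coloring n cmax} {u w₁ w₂ : Fin n} {c : Fin cmax}
    → MoveResult G col (u , c) col'
    → ¬ InComp G col u w₁ → ¬ InComp G col u w₂ → col w₁ ≢ col w₂
    → ¬ Constant col'
  move-keeps-outside-distinct {w₁ = w₁} {w₂} result out₁ out₂ distinct const =
    distinct (trans (≡-sym (proj₂ (result w₁) out₁))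
             (trans (constant⇒equal const w₁ w₂) (proj₂ (result w₂) out₂)))

  pivot-needs-two-moves :
    {col : Coloring n cmax} {p w₁ w₂ : Fin n}
    → ¬ InComp G col p w₁ → ¬ InComp G col p w₂ → col w₁ ≢ col w₂
    → ∀ ms → AtPivot p ms → Floods G col ms → 2 ≤ length ms
  pivot-needs-two-moves {w₁ = w₁} {w₂} _ _ distinct [] _ (_ , done , const) =
    ⊥-elim (distinct (constant⇒equal const w₁ w₂))
  pivot-needs-two-moves out₁ out₂ distinct (_ ∷ []) ((c , refl) ∷ [])
                        (_ , cons result done , const) =
    ⊥-elim (move-keeps-outside-distinct result out₁ out₂ distinct const)
  pivot-needs-two-moves _ _ _ (_ ∷ _ ∷ _) _ _ = s≤s (s≤s z≤n)

pattern v0 = zero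
pattern v1 = suc zero
pattern v2 = suc (suc zero)

pattern red  = zero
pattern blue = suc zero

path-adj : Fin 3 → Fin 3 → Bool
path-adj v0 v1 = true
path-adj v1 v0 = true
path-adj v1 v2 = true
path-adj v2 v1 = true
path-adj _  _  = false

path-adj-sym : ∀ u v → path-adj u v ≡ path-adj v u
path-adj-sym v0 v0 = refl
path-adj-sym v0 v1 = refl
path-adj-sym v0 v2 = refl
path-adj-sym v1 v0 = refl
path-adj-sym v1 v1 = refl
path-adj-sym v1 v2 = refl
path-adj-sym v2 v0 = refl
path-adj-sym v2 v1 = refl
path-adj-sym v2 v2 = refl

path-adj-irrefl : ∀ u → path-adj u u ≡ false
path-adj-irrefl v0 = refl
path-adj-irrefl v1 = refl
path-adj-irrefl v2 = refl

path : Graph 3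
path = record { Adj = path-adj ; sym = path-adj-sym ; irrfl = path-adj-irrefl }

path-connected : Connected path
path-connected v0 v0 = here
path-connected v0 v1 = step here refl
path-connected v0 v2 = step {v = v1} (step here refl) refl
path-connected v1 v0 = step here refl
path-connected v1 v1 = here
path-connected v1 v2 = step here refl
path-connected v2 v0 = step {v = v1} (step here refl) refl
path-connected v2 v1 = step here refl
path-connected v2 v2 = here

alternating : Coloring 3 2
alternating v0 = red
alternating v1 = blue
alternating v2 = red

blue-blue-red : Coloring 3 2
blue-blue-red v0 = blue
blue-blue-red v1 = blue
blue-blue-red v2 = red

all-red : Coloring 3 2
all-red _ = red

all-red-constant : Constant all-red
all-red-constant = red , λ _ → refl

-- The end vertex is its own monochromatic component: its only neighbour
-- has a different colour.
pivot-component : ∀ {w} → InComp path alternating v0 w → w ≡ v0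
pivot-component here = refl
pivot-component (step {w = w} r adj same) with pivot-component r
pivot-component (step {w = v0} r () same) | refl
pivot-component (step {w = v1} r adj ()) | refl
pivot-component (step {w = v2} r () same) | refl

v1-outside : ¬ InComp path alternating v0 v1
v1-outside i with pivot-component i
... | ()

v2-outside : ¬ InComp path alternating v0 v2
v2-outside i with pivot-component i
... | ()

blue≢red : alternating v1 ≢ alternating v2
blue≢red ()

alternating-nonconstant : ¬ Constant alternating
alternating-nonconstant const = blue≢red (constant⇒equal const v1 v2)

middle-to-red : MoveResult path alternating (v1 , red) all-red
middle-to-red v0 = (λ _ → refl) , (λ _ → refl)
middle-to-red v1 = (λ _ → refl) , (λ out → ⊥-elim (out here))
middle-to-red v2 = (λ _ → refl) , (λ _ → refl)

pivot-to-blue : MoveResult path alternating (v0 , blue) blue-blue-red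
pivot-to-blue v0 = (λ _ → refl) , (λ out → ⊥-elim (out here))
pivot-to-blue v1 = (λ _ → refl) , (λ _ → refl)
pivot-to-blue v2 = (λ i → ⊥-elim (v2-outside i)) , (λ _ → refl)

pivot-to-red : MoveResult path blue-blue-red (v0 , red) all-red
pivot-to-red v0 = (λ _ → refl) , (λ out → ⊥-elim (out here))
pivot-to-red v1 = (λ _ → refl) , (λ out → ⊥-elim (out (step here refl refl)))
pivot-to-red v2 = (λ _ → refl) , (λ _ → refl)

free-optimum : IsOPTFree path alternating 1
free-optimum =
  ((v1 , red) ∷ [] , (all-red , cons middle-to-red done , all-red-constant) , refl)
  , nonconstant⇒needs-move alternating-nonconstant

fixed-optimum : IsOPTFixed path alternating v0 2
fixed-optimum =
  ( (v0 , blue) ∷ (v0 , red) ∷ []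
  , (blue , refl) ∷ (red , refl) ∷ []
  , (all-red , cons pivot-to-blue (cons pivot-to-red done) , all-red-constant)
  , refl )
  , pivot-needs-two-moves v1-outside v2-outside blue≢red

theorem17 : Σ ℕ λ n → Σ ℕ λ cmax → Σ (Graph n) λ G → Σ (Coloring n cmax) λ col → Σ (Fin n) λ p → Σ ℕ λ k →
    Connected G × IsOPTFree G col k × 0 < k × IsOPTFixed G col p (2 * k)
theorem17 =
  3 , 2 , path , alternating , v0 , 1
  , path-connected , free-optimum , s≤s z≤n , fixed-optimum
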